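{- Let $\mathscr{R}$ be an integral domain, $P,Q\in\mathscr{R}$ non-zero, and $U$ the Lucas sequence with parameters $P,Q$, assumed non-degenerate. Let $\mathfrak{a}\subsetneq\mathscr{R}$ be a proper ideal with $(P)+(Q)+\mathfrak{a}=\mathscr{R}$. Then either $(Q)+\mathfrak{a}=\mathscr{R}$ or $\rho_U(\mathfrak{a})=+\infty$.
   Context: The Lucas sequence with parameters $P,Q$ is defined by $U_0=0$, $U_1=1$, $U_{n+2}=PU_{n+1}-QU_n$ ($n\ge0$); it is non-degenerate if $U_n\ne0$ for all $n\ge1$. For a proper ideal $\mathfrak{a}$, the rank of appearance $\rho_U(\mathfrak{a})$ is the least integer $n\ge1$ with $U_n\in\mathfrak{a}$, and $\rho_U(\mathfrak{a})=+\infty$ if no such $n$ exists. -}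

module Defs where

open import Level using (Level; _⊔_; suc)
open import Algebra.Bundles using (CommutativeRing)
open import Data.Nat using (ℕ; zero) renaming (suc to sucℕ; _≥_ to _≥ℕ_)
open import Data.Product using (Σ; _×_; ∃-syntax)
open import Data.Sum using (_⊎_)
open import Relation.Nullary using (¬_)

module _ {c ℓ : Level} (R : CommutativeRing c ℓ) where
  open CommutativeRing R

  record IsIntegralDomain : Set (c ⊔ ℓ) where
    field
      1≉0 : ¬ (1# ≈ 0#)
      noZeroDivisors : ∀ x y → x * y ≈ 0# → (x ≈ 0#) ⊎ (y ≈ 0#)

  record IsIdeal {i : Level} (𝔞 : Carrier → Set i) : Set (c ⊔ ℓ ⊔ i) where
    field
      respects : ∀ {x y} → x ≈ y → 𝔞 x → 𝔞 y
      zero∈ : 𝔞 0#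
      +-closed : ∀ {x y} → 𝔞 x → 𝔞 y → 𝔞 (x + y)
      *-closed : ∀ r {x} → 𝔞 x → 𝔞 (r * x)

  IsProper : {i : Level} → (Carrier → Set i) → Set (c ⊔ i)
  IsProper 𝔞 = ¬ (∀ r → 𝔞 r)

  InPQa : {i : Level} → Carrier → Carrier → (Carrier → Set i) → Carrier → Set (c ⊔ ℓ ⊔ i)
  InPQa P Q 𝔞 r = ∃[ x ] ∃[ y ] ∃[ z ] (𝔞 z × r ≈ x * P + y * Q + z)

  InQa : {i : Level} → Carrier → (Carrier → Set i) → Carrier → Set (c ⊔ ℓ ⊔ i)
  InQa Q 𝔞 r = ∃[ y ] ∃[ z ] (𝔞 z × r ≈ y * Q + z)

  lucasU : Carrier → Carrier → ℕ → Carrier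
  lucasU P Q zero = 0#
  lucasU P Q (sucℕ zero) = 1#
  lucasU P Q (sucℕ (sucℕ n)) = P * lucasU P Q (sucℕ n) - Q * lucasU P Q n

  NonDegenerate : Carrier → Carrier → Set ℓ
  NonDegenerate P Q = ∀ n → n ≥ℕ 1 → ¬ (lucasU P Q n ≈ 0#)

  -- ρ_U(𝔞) = +∞ : there is no n ≥ 1 with U_n ∈ 𝔞.
  RankInfinite : {i : Level} → Carrier → Carrier → (Carrier → Set i) → Set i
  RankInfinite P Q 𝔞 = ∀ n → n ≥ℕ 1 → ¬ 𝔞 (lucasU P Q n)

-- Since U₁ = 1 and U_{n+2} ≡ P U_{n+1} modulo Q, we have U_{n+1} ≡ Pⁿ modulo (Q).
-- So if U_{n+1} ∈ 𝔞 then Pⁿ ∈ (Q) + 𝔞. The hypothesis (P) + (Q) + 𝔞 = R says that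
-- P is a unit modulo the ideal (Q) + 𝔞, so Pⁿ can be cancelled, and 1 ∈ (Q) + 𝔞.
module Submission where

open import Defs
open import Level using (Level; _⊔_)
open import Algebra.Bundles using (CommutativeRing)
open import Data.Nat using (zero; suc)
open import Data.Product using (_,_; _×_; ∃-syntax)
open import Data.Sum using (_⊎_; inj₁; inj₂)
open import Relation.Nullary using (¬_)

module _ {c ℓ : Level} (R : CommutativeRing c ℓ) where
  open CommutativeRing R
  open import Algebra.Properties.Semiring.Exp semiring using (_^_)
  open import Algebra.Properties.Ring ring using (-‿distribˡ-*)
  open import Algebra.Properties.Group +-group using (\\-leftDividesʳ)
  open import Algebra.Properties.CommutativeSemigroup +-commutativeSemigroup using (interchange)
  open import Relation.Binary.Reasoning.Setoid setoid

  lucasU-suc≈^-mod-Q : ∀ P Q n → ∃[ y ] (lucasU R P Q (suc n) ≈ P ^ n + y * Q)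
  lucasU-suc≈^-mod-Q P Q zero = 0# , sym (trans (+-congˡ (zeroˡ Q)) (+-identityʳ 1#))
  lucasU-suc≈^-mod-Q P Q (suc n) with lucasU-suc≈^-mod-Q P Q n
  ... | y , U≈ = P * y - u , (begin
    P * lucasU R P Q (suc n) - Q * u    ≈⟨ +-congʳ (*-congˡ U≈) ⟩
    P * (P ^ n + y * Q) - Q * u         ≈⟨ +-cong (distribˡ P (P ^ n) (y * Q)) (-‿cong (*-comm Q u)) ⟩
    (P ^ suc n + P * (y * Q)) - u * Q   ≈⟨ +-assoc _ _ _ ⟩
    P ^ suc n + (P * (y * Q) - u * Q)   ≈⟨ +-congˡ (+-cong (sym (*-assoc P y Q)) (-‿distribˡ-* u Q)) ⟩
    P ^ suc n + ((P * y) * Q + - u * Q) ≈⟨ +-congˡ (sym (distribʳ Q (P * y) (- u))) ⟩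
    P ^ suc n + (P * y - u) * Q         ∎)
    where u = lucasU R P Q n

  IsUnitModulo : {i : Level} → (Carrier → Set i) → Carrier → Set (c ⊔ ℓ ⊔ i)
  IsUnitModulo J a = ∃[ x ] ∃[ j ] (J j × 1# ≈ x * a + j)

  module _ {i : Level} {J : Carrier → Set i} (J-ideal : IsIdeal R J) where
    open IsIdeal J-ideal

    1∈⇒∀∈ : J 1# → ∀ r → J r
    1∈⇒∀∈ 1∈J r = respects (*-identityʳ r) (*-closed r 1∈J)

    unitModulo-cancel : ∀ {a} → IsUnitModulo J a → ∀ b → J (a * b) → J b
    unitModulo-cancel {a} (x , j , j∈J , 1≈) b ab∈J =
      respects b≈ (+-closed (*-closed x ab∈J) (*-closed b j∈J))
      where
      b≈ : x * (a * b) + b * j ≈ b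
      b≈ = begin
        x * (a * b) + b * j   ≈⟨ +-congʳ (trans (*-congˡ (*-comm a b)) (sym (*-assoc x b a))) ⟩
        (x * b) * a + b * j   ≈⟨ +-congʳ (trans (*-congʳ (*-comm x b)) (*-assoc b x a)) ⟩
        b * (x * a) + b * j   ≈⟨ distribˡ b (x * a) j ⟨
        b * (x * a + j)       ≈⟨ *-congˡ 1≈ ⟨
        b * 1#                ≈⟨ *-identityʳ b ⟩
        b                     ∎

    unitModulo-^-cancel : ∀ {a} → IsUnitModulo J a → ∀ n → J (a ^ n) → J 1#
    unitModulo-^-cancel a-unit zero    aⁿ∈J = aⁿ∈J
    unitModulo-^-cancel a-unit (suc n) aⁿ∈J =
      unitModulo-^-cancel a-unit n (unitModulo-cancel a-unit _ aⁿ∈J)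

  module _ {i : Level} (P Q : Carrier) {𝔞 : Carrier → Set i} (𝔞-ideal : IsIdeal R 𝔞) where
    open IsIdeal 𝔞-ideal

    InQa-isIdeal : IsIdeal R (InQa R Q 𝔞)
    InQa-isIdeal = record
      { respects = λ { x≈x′ (y , z , z∈𝔞 , x≈) → y , z , z∈𝔞 , trans (sym x≈x′) x≈ }
      ; zero∈    = 0# , 0# , zero∈ , sym (trans (+-identityʳ (0# * Q)) (zeroˡ Q))
      ; +-closed = λ { (y , z , z∈𝔞 , x≈) (y′ , z′ , z′∈𝔞 , x′≈) →
                       y + y′ , z + z′ , +-closed z∈𝔞 z′∈𝔞 , +-witness x≈ x′≈ }
      ; *-closed = λ { r (y , z , z∈𝔞 , x≈) →
                       r * y , r * z , *-closed r z∈𝔞 , *-witness r x≈ }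
      }
      where
      +-witness : ∀ {x x′ y y′ z z′} → x ≈ y * Q + z → x′ ≈ y′ * Q + z′ →
                  x + x′ ≈ (y + y′) * Q + (z + z′)
      +-witness {x} {x′} {y} {y′} {z} {z′} x≈ x′≈ = begin
        x + x′                          ≈⟨ +-cong x≈ x′≈ ⟩
        (y * Q + z) + (y′ * Q + z′)     ≈⟨ interchange (y * Q) z (y′ * Q) z′ ⟩
        (y * Q + y′ * Q) + (z + z′)     ≈⟨ +-congʳ (distribʳ Q y y′) ⟨
        (y + y′) * Q + (z + z′)         ∎
      *-witness : ∀ r {x y z} → x ≈ y * Q + z → r * x ≈ (r * y) * Q + r * z
      *-witness r {x} {y} {z} x≈ = begin
        r * x                ≈⟨ *-congˡ x≈ ⟩
        r * (y * Q + z)      ≈⟨ distribˡ r (y * Q) z ⟩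
        r * (y * Q) + r * z  ≈⟨ +-congʳ (*-assoc r y Q) ⟨
        (r * y) * Q + r * z  ∎

    InPQa-whole⇒unitModulo-InQa : (∀ r → InPQa R P Q 𝔞 r) → IsUnitModulo (InQa R Q 𝔞) P
    InPQa-whole⇒unitModulo-InQa PQa-whole with PQa-whole 1#
    ... | x , y , z , z∈𝔞 , 1≈ =
      x , y * Q + z , (y , z , z∈𝔞 , refl) , trans 1≈ (+-assoc (x * P) (y * Q) z)

    lucasU-suc∈⇒^∈InQa : ∀ n → 𝔞 (lucasU R P Q (suc n)) → InQa R Q 𝔞 (P ^ n)
    lucasU-suc∈⇒^∈InQa n U∈𝔞 with lucasU-suc≈^-mod-Q P Q n
    ... | y , U≈ = - y , lucasU R P Q (suc n) , U∈𝔞 , (begin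
      P ^ n                          ≈⟨ \\-leftDividesʳ (y * Q) (P ^ n) ⟨
      - (y * Q) + (y * Q + P ^ n)    ≈⟨ +-cong (-‿distribˡ-* y Q) (trans (+-comm (y * Q) (P ^ n)) (sym U≈)) ⟩
      - y * Q + lucasU R P Q (suc n) ∎)

    lucasU-suc∈⇒InQa-whole : (∀ r → InPQa R P Q 𝔞 r) →
                              ∀ n → 𝔞 (lucasU R P Q (suc n)) → ∀ r → InQa R Q 𝔞 r
    lucasU-suc∈⇒InQa-whole PQa-whole n U∈𝔞 =
      1∈⇒∀∈ InQa-isIdeal
        (unitModulo-^-cancel InQa-isIdeal (InPQa-whole⇒unitModulo-InQa PQa-whole) n
          (lucasU-suc∈⇒^∈InQa n U∈𝔞))

mainTheorem9 : {c ℓ i : Level} (R : CommutativeRing c ℓ) → IsIntegralDomain R →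
    (P Q : CommutativeRing.Carrier R) →
    ¬ (CommutativeRing._≈_ R P (CommutativeRing.0# R)) →
    ¬ (CommutativeRing._≈_ R Q (CommutativeRing.0# R)) →
    NonDegenerate R P Q →
    (𝔞 : CommutativeRing.Carrier R → Set i) → IsIdeal R 𝔞 → IsProper R 𝔞 →
    (∀ r → InPQa R P Q 𝔞 r) →
    ¬ ¬ ((∀ r → InQa R Q 𝔞 r) ⊎ RankInfinite R P Q 𝔞)
mainTheorem9 R _ P Q _ _ _ 𝔞 𝔞-ideal _ PQa-whole neither = neither (inj₂ rank-infinite)
  where
  rank-infinite : RankInfinite R P Q 𝔞
  rank-infinite zero    ()
  rank-infinite (suc n) _ U∈𝔞 =
    neither (inj₁ (lucasU-suc∈⇒InQa-whole R P Q 𝔞-ideal PQa-whole n U∈𝔞))
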